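{- Let $m\ge 3$ be odd and let $b$ be an integer with $3m+1\le b\le 4m+1$ or $8m\le b\le 9m+1$. Then $G(6m,b)$ has a $(6m,b)$-admissible path partition $K_b$, and there exist $(m-1)!$ pairwise Klein bottle nonequivalent $C_4$-face-magic Klein bottle labelings $X$ of $\mathcal{K}_{m,6}$ with $\mathcal{L}(X)=K_b$.
   Context: Here $n=6$. $\mathcal{K}_{m,6}$: vertex set $\{(i,j):1\le i\le m,1\le j\le 6\}$, edges $(i,j)(i,j+1)$ ($j\le 5$), $(i,6)(i,1)$, $(i,j)(i+1,j)$ ($i\le m-1$), $(m,j)(1,7-j)$. Its $4$-cycle faces (column indices mod $6$): $\{(i,j),(i,j+1),(i+1,j),(i+1,j+1)\}$, $1\le i\le m-1$, and $\{(m,j),(m,j+1),(1,7-j),(1,6-j)\}$. A $C_4$-face-magic Klein bottle labeling is a bijection $(i,j)\mapsto x_{i,j}$ onto $\{1,\dots,6m\}$ with all face sums equal. Equivalence: with $U(i,j)=(i+1,j)$ ($i<m$), $U(m,j)=(1,7-j)$, $H(i,j)=(i,j+3)$ (mod $6$), $F(i,j)=(i,7-j)$, $KBLS(m,6)=\langle U,H,F\rangle$; $X,X'$ are Klein bottle equivalent if $X'=\{x_{A(i,j)}\}$ for some $A\in KBLS(m,6)$. For integers $a_1,a_2$, $G(a_1,a_2)$ has vertex set $\{\{q,6m+1-q\}:1\le q\le 3m\}$; distinct vertices $\{x_1,x_2\},\{y_1,y_2\}$ are adjacent iff $z_1+z_2\in\{a_1,a_2\}$ for some $z_1\in\{x_1,x_2\}$,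 $z_2\in\{y_1,y_2\}$. A path on $3$ distinct vertices $V_1,V_2,V_3$ is $(a_1,a_2)$-admissible if there are $z_j\in V_j$ with $z_1+z_2=a_1$, $z_2+z_3=a_2$. An $(a_1,a_2)$-admissible path partition is a spanning subgraph of $G(a_1,a_2)$ that is a disjoint union of $m$ distinct admissible paths. For a $C_4$-face-magic labeling $X$, $\mathcal{L}(X)$ is the graph on the same vertex set with edges between $\{x_{2i-1,j},6m+1-x_{2i-1,j}\}$ and $\{x_{2i-1,j+1},6m+1-x_{2i-1,j+1}\}$ for $1\le i\le (m+1)/2$, $j=1,2$, and between $\{x_{2i,7-j},6m+1-x_{2i,7-j}\}$ and $\{x_{2i,6-j},6m+1-x_{2i,6-j}\}$ for $1\le i\le (m-1)/2$, $j=1,2$. -}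

module Defs where

open import Data.Nat using (ℕ; zero; suc; _+_; _*_; _≤_; _<_; _<?_; _!; _∸_; s≤s; z≤n)
open import Data.Fin using (Fin; zero; suc; toℕ; fromℕ; fromℕ<; inject₁)
open import Data.Product using (Σ; ∃; _×_; _,_)
open import Data.Sum using (_⊎_)
open import Data.List using (List; []; _∷_)
open import Relation.Binary.PropositionalEquality using (_≡_; _≢_)
open import Relation.Nullary using (¬_; yes; no)
open import Function.Bundles using (_⇔_)

-- Conventions: rows 1..m and columns 1..6 of the paper are represented
-- 0-based by Fin m and Fin 6 (paper row i = toℕ r + 1, column j = toℕ c + 1).

Odd : ℕ → Set
Odd m = Σ ℕ λ k → m ≡ suc (2 * k)

nextCol : Fin 6 → Fin 6
nextCol zero = suc zero
nextCol (suc zero) = suc (suc zero)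
nextCol (suc (suc zero)) = suc (suc (suc zero))
nextCol (suc (suc (suc zero))) = suc (suc (suc (suc zero)))
nextCol (suc (suc (suc (suc zero)))) = suc (suc (suc (suc (suc zero))))
nextCol (suc (suc (suc (suc (suc zero))))) = zero

-- column j ↦ 7 - j  (0-based: c ↦ 5 - c)
flipCol : Fin 6 → Fin 6
flipCol zero = suc (suc (suc (suc (suc zero))))
flipCol (suc zero) = suc (suc (suc (suc zero)))
flipCol (suc (suc zero)) = suc (suc (suc zero))
flipCol (suc (suc (suc zero))) = suc (suc zero)
flipCol (suc (suc (suc (suc zero)))) = suc zero
flipCol (suc (suc (suc (suc (suc zero))))) = zero

shift3Col : Fin 6 → Fin 6
shift3Col zero = suc (suc (suc zero))
shift3Col (suc zero) = suc (suc (suc (suc zero)))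
shift3Col (suc (suc zero)) = suc (suc (suc (suc (suc zero))))
shift3Col (suc (suc (suc zero))) = zero
shift3Col (suc (suc (suc (suc zero)))) = suc zero
shift3Col (suc (suc (suc (suc (suc zero))))) = suc (suc zero)

Vtx : ℕ → Set
Vtx m = Fin m × Fin 6

Labeling : ℕ → Set
Labeling m = Vtx m → ℕ

IsBijectiveLabeling : (m : ℕ) → Labeling m → Set
IsBijectiveLabeling m X =
  (∀ v → 1 ≤ X v × X v ≤ 6 * m) ×
  (∀ v w → X v ≡ X w → v ≡ w) ×
  (∀ k → 1 ≤ k → k ≤ 6 * m → ∃ λ v → X v ≡ k)

AllFaceSums : (m : ℕ) → Labeling m → ℕ → Set
AllFaceSums m X s =
  (∀ (r r' : Fin m) (c : Fin 6) → toℕ r' ≡ suc (toℕ r) →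
     X (r , c) + X (r , nextCol c) + X (r' , c) + X (r' , nextCol c) ≡ s) ×
  (∀ (rl r1 : Fin m) (c : Fin 6) → suc (toℕ rl) ≡ m → toℕ r1 ≡ 0 →
     X (rl , c) + X (rl , nextCol c) + X (r1 , flipCol c)
       + X (r1 , flipCol (nextCol c)) ≡ s)

IsC4FaceMagicKB : (m : ℕ) → Labeling m → Set
IsC4FaceMagicKB m X = IsBijectiveLabeling m X × Σ ℕ λ s → AllFaceSums m X s

U : ∀ {m} → Vtx m → Vtx m
U {suc k} (r , c) with suc (toℕ r) <? suc k
... | yes p = (fromℕ< p , c)
... | no _ = (zero , flipCol c)

U⁻¹ : ∀ {m} → Vtx m → Vtx m
U⁻¹ {suc k} (zero , c) = (fromℕ k , flipCol c)
U⁻¹ {suc k} (suc r , c) = (inject₁ r , c)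

H : ∀ {m} → Vtx m → Vtx m
H (r , c) = (r , shift3Col c)

F : ∀ {m} → Vtx m → Vtx m
F (r , c) = (r , flipCol c)

-- generators together with inverses (H and F are involutions)
data Gen : Set where
  gU gU⁻¹ gH gF : Gen

genAct : ∀ {m} → Gen → Vtx m → Vtx m
genAct gU = U
genAct gU⁻¹ = U⁻¹
genAct gH = H
genAct gF = F

-- every element of KBLS(m,6) is the composite of a word in the generators
wordAct : ∀ {m} → List Gen → Vtx m → Vtx m
wordAct [] v = v
wordAct (g ∷ w) v = genAct g (wordAct w v)

KBEquivalent : (m : ℕ) → Labeling m → Labeling m → Set
KBEquivalent m X X' = Σ (List Gen) λ w → ∀ v → X' v ≡ X (wordAct w v)

-- The graph G(a₁,a₂): a vertex {q, 6m+1-q} (1 ≤ q ≤ 3m) is represented by q.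

IsGVertex : ℕ → ℕ → Set
IsGVertex m q = 1 ≤ q × q ≤ 3 * m

Mem : ℕ → ℕ → ℕ → Set
Mem m q z = (z ≡ q) ⊎ (z + q ≡ suc (6 * m))

GAdj : ℕ → ℕ → ℕ → ℕ → ℕ → Set
GAdj m a₁ a₂ u v =
  IsGVertex m u × IsGVertex m v × u ≢ v ×
  ∃ λ z₁ → ∃ λ z₂ → Mem m u z₁ × Mem m v z₂ × ((z₁ + z₂ ≡ a₁) ⊎ (z₁ + z₂ ≡ a₂))

Path3 : Set
Path3 = ℕ × ℕ × ℕ

OnPath : Path3 → ℕ → Set
OnPath (p₁ , p₂ , p₃) q = (q ≡ p₁) ⊎ (q ≡ p₂) ⊎ (q ≡ p₃)

PathEdge : Path3 → ℕ → ℕ → Set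
PathEdge (p₁ , p₂ , p₃) u v =
  (u ≡ p₁ × v ≡ p₂) ⊎ (u ≡ p₂ × v ≡ p₁) ⊎ (u ≡ p₂ × v ≡ p₃) ⊎ (u ≡ p₃ × v ≡ p₂)

IsAdmissiblePath : ℕ → ℕ → ℕ → Path3 → Set
IsAdmissiblePath m a₁ a₂ (p₁ , p₂ , p₃) =
  IsGVertex m p₁ × IsGVertex m p₂ × IsGVertex m p₃ ×
  p₁ ≢ p₂ × p₂ ≢ p₃ × p₁ ≢ p₃ ×
  ∃ λ z₁ → ∃ λ z₂ → ∃ λ z₃ →
    Mem m p₁ z₁ × Mem m p₂ z₂ × Mem m p₃ z₃ × z₁ + z₂ ≡ a₁ × z₂ + z₃ ≡ a₂

Graph : Set₁
Graph = ℕ → ℕ → Set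

SameGraph : Graph → Graph → Set
SameGraph E E' = ∀ u v → E u v ⇔ E' u v

IsAdmissiblePathPartition : ℕ → ℕ → ℕ → Graph → Set
IsAdmissiblePathPartition m a₁ a₂ K =
  (∀ u v → K u v → GAdj m a₁ a₂ u v) ×
  Σ (Fin m → Path3) λ P →
    (∀ t → IsAdmissiblePath m a₁ a₂ (P t)) ×
    (∀ t t' → t ≢ t' → ∀ q → OnPath (P t) q → ¬ OnPath (P t') q) ×
    (∀ q → IsGVertex m q → ∃ λ t → OnPath (P t) q) ×
    (∀ u v → K u v ⇔ (∃ λ t → PathEdge (P t) u v))

-- allowed column pairs (0-based) in row r: paper rows 2i-1 (toℕ r even)
-- use columns (1,2),(2,3); paper rows 2i (toℕ r odd) use (6,5),(5,4).
data EvenN : ℕ → Set where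
  ev0 : EvenN 0
  ev2 : ∀ {n} → EvenN n → EvenN (suc (suc n))

data OddN : ℕ → Set where
  od1 : OddN 1
  od2 : ∀ {n} → OddN n → OddN (suc (suc n))

LPair : ∀ {m} → Fin m → Fin 6 → Fin 6 → Set
LPair r c c' =
  (EvenN (toℕ r) × ((toℕ c ≡ 0 × toℕ c' ≡ 1) ⊎ (toℕ c ≡ 1 × toℕ c' ≡ 2))) ⊎
  (OddN (toℕ r) × ((toℕ c ≡ 5 × toℕ c' ≡ 4) ⊎ (toℕ c ≡ 4 × toℕ c' ≡ 3)))

LGraph : (m : ℕ) → Labeling m → Graph
LGraph m X u v =
  IsGVertex m u × IsGVertex m v ×
  ∃ λ r → ∃ λ c → ∃ λ c' → LPair r c c' ×
    ((Mem m u (X (r , c)) × Mem m v (X (r , c'))) ⊎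
     (Mem m v (X (r , c)) × Mem m u (X (r , c'))))

-- Write m = 2h + 1 and call 6m + 1 − x the partner of a label x, so that the vertices of
-- G(6m, b) are the pairs {x, partner x}.  Put b = 3m + E or b = 9m + 1 − E with E ≤ m + 1, and for
-- k < m let mid k = 2k + 1 + (k + 1 ∸ E) and far k = 3m + E − mid k.  The paths
-- {mid k + 1} — {mid k} — {far k} are (6m, b)-admissible, because (6m − mid k) + mid k = 6m, and
-- together they meet every vertex exactly once: a vertex q ≤ 3m is mid k or mid k + 1 when
-- q ≤ min(2E, 2m), one of mid k, mid k + 1, far k (according to q − 2E − 1 mod 3) when
-- 2E < q ≤ 3m − E, and far k or its partner when q > 3m − E.
-- Row k of a labeling holds the three labels of the k-th path, with edge sums 6m and b, followed by
-- their partners in reverse order.  Any two such rows have equal sums over consecutive columns, so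
-- with the rows alternately straight and mirrored every 4-cycle face sums to 2(6m + 1); the number
-- of rows is odd, so the twisted edge joins two straight rows.  The labels exhaust 1..6m, hence are
-- distinct.  Permuting the paths in rows 2..m yields (m − 1)! labelings with the same path
-- partition.  A Klein bottle symmetry acts on rows by a rotation; one relating two of these
-- labelings fixes row 1, where both put the first path, so it fixes every row and the two
-- permutations coincide.

module Submission where

open import Defs
open import Data.Nat
open import Data.Nat.Properties
open import Data.Nat.DivMod using (DivMod; _divMod_; result)
open import Data.Nat.Tactic.RingSolver using (solve)
open import Data.Bool using (Bool; true; false; not)
open import Data.Fin as Fin using (Fin; zero; suc; toℕ; fromℕ<; remQuot; combine; punchIn; punchOut)
open import Data.Fin.Properties as FinProps
  using (toℕ-injective; toℕ-fromℕ<; toℕ-fromℕ; toℕ-inject₁; toℕ<n; combine-remQuot; remQuot-combine;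
         punchIn-injective; punchOut-injective; injective⇒≤; any?)
open import Data.Fin.Patterns using (0F; 1F; 2F; 3F; 4F; 5F)
open import Data.Fin.Permutation as Perm
  using (Permutation′; _⟨$⟩ʳ_; _⟨$⟩ˡ_; insert; insert-punchIn; lift₀; inverseʳ)
open import Data.Product using (Σ; ∃; ∃₂; _×_; _,_; proj₁; proj₂; uncurry)
open import Data.Sum as Sum using (_⊎_; inj₁; inj₂)
open import Data.List using (List; []; _∷_)
open import Function using (_∘_; id)
open import Function.Bundles using (Injection; mk⇔)
open import Function.Properties.Inverse using (↔⇒↣)
open import Relation.Binary.PropositionalEquality
open import Relation.Nullary using (¬_; yes; no; contradiction)

+-interchange : ∀ a b c d → a + b + (c + d) ≡ (a + c) + (b + d)
+-interchange a b c d = solve (a ∷ b ∷ c ∷ d ∷ [])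

+-swap-pairs : ∀ a b c d → a + b + c + d ≡ c + d + a + b
+-swap-pairs a b c d = solve (a ∷ b ∷ c ∷ d ∷ [])

m*2<2*n⇒m<n : ∀ {m n} → m * 2 < 2 * n → m < n
m*2<2*n⇒m<n {m} {n} = *-cancelʳ-< 2 m n ∘ subst (m * 2 <_) (*-comm 2 n)

-- Pigeonhole on Fin n and an enumeration of the permutations of Fin n

injective⇒surjective : ∀ {n} {f : Fin n → Fin n} → (∀ {x y} → f x ≡ f y → x ≡ y) → ∀ y → ∃ λ x → f x ≡ y
injective⇒surjective {zero} _ ()
injective⇒surjective {suc n} {f} f-inj y with any? (λ x → f x Fin.≟ y)
... | yes hit = hit
... | no miss = contradiction (injective⇒≤ {f = avoid} avoid-injective) 1+n≰n
  where
  y≢f : ∀ x → y ≢ f x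
  y≢f x y≡fx = miss (x , sym y≡fx)
  avoid : Fin (suc n) → Fin n
  avoid x = punchOut (y≢f x)
  avoid-injective : ∀ {a b} → avoid a ≡ avoid b → a ≡ b
  avoid-injective eq = f-inj (punchOut-injective (y≢f _) (y≢f _) eq)

surjective⇒injective : ∀ {n} {f : Fin n → Fin n} → (∀ y → ∃ λ x → f x ≡ y) → ∀ {a b} → f a ≡ f b → a ≡ b
surjective⇒injective {n} {f} f-surj {a} {b} fa≡fb = begin
  a                ≡⟨ section-retraction a ⟨
  section (f a)    ≡⟨ cong section fa≡fb ⟩
  section (f b)    ≡⟨ section-retraction b ⟩
  b                ∎
  where
  open ≡-Reasoning
  section : Fin n → Fin n
  section y = proj₁ (f-surj y)
  f∘section : ∀ y → f (section y) ≡ y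
  f∘section y = proj₂ (f-surj y)
  section-injective : ∀ {y y'} → section y ≡ section y' → y ≡ y'
  section-injective {y} {y'} eq = trans (sym (f∘section y)) (trans (cong f eq) (f∘section y'))
  section-retraction : ∀ x → section (f x) ≡ x
  section-retraction x with injective⇒surjective section-injective x
  ... | y , refl = cong section (f∘section y)

insertAtZero : ∀ {n} → (Fin (n !) → Permutation′ n) → Fin (suc n) × Fin (n !) → Permutation′ (suc n)
insertAtZero perms (i , j) = insert zero i (perms j)

insertAtZero-injective : ∀ {n} {perms : Fin (n !) → Permutation′ n} →
  (∀ {j j'} → perms j Perm.≈ perms j' → j ≡ j') →
  ∀ {p p'} → insertAtZero perms p Perm.≈ insertAtZero perms p' → p ≡ p'
insertAtZero-injective {perms = perms} perms-inj {i , j} {i' , j'} eq with eq zero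
... | refl = cong (i ,_) (perms-inj λ x → punchIn-injective i _ _ (begin
  punchIn i (perms j ⟨$⟩ʳ x)        ≡⟨ insert-punchIn zero i (perms j) x ⟨
  insertAtZero perms (i , j) ⟨$⟩ʳ suc x ≡⟨ eq (suc x) ⟩
  insertAtZero perms (i , j') ⟨$⟩ʳ suc x ≡⟨ insert-punchIn zero i (perms j') x ⟩
  punchIn i (perms j' ⟨$⟩ʳ x)       ∎))
  where open ≡-Reasoning

allPermutations : (n : ℕ) → Fin (n !) → Permutation′ n
allPermutations zero    _ = Perm.id
allPermutations (suc n) k = insertAtZero (allPermutations n) (remQuot (n !) k)

allPermutations-injective : ∀ n {k k'} → allPermutations n k Perm.≈ allPermutations n k' → k ≡ k'
allPermutations-injective zero {zero} {zero} _ = refl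
allPermutations-injective (suc n) {k} {k'} π≈π' = begin
  k                                   ≡⟨ combine-remQuot {suc n} (n !) k ⟨
  uncurry combine (remQuot (n !) k)   ≡⟨ cong (uncurry combine) pairs≡ ⟩
  uncurry combine (remQuot (n !) k')  ≡⟨ combine-remQuot {suc n} (n !) k' ⟩
  k'                                  ∎
  where
  open ≡-Reasoning
  pairs≡ : remQuot {suc n} (n !) k ≡ remQuot (n !) k'
  pairs≡ = insertAtZero-injective {perms = allPermutations n} (allPermutations-injective n) π≈π'

-- Rows of the Klein bottle

nextRow : ∀ {k} → Fin (suc k) → Fin (suc k)
nextRow r = proj₁ (U (r , 0F))

prevRow : ∀ {k} → Fin (suc k) → Fin (suc k)
prevRow r = proj₁ (U⁻¹ (r , 0F))

row-U : ∀ {k} (v : Vtx (suc k)) → proj₁ (U v) ≡ nextRow (proj₁ v)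
row-U {k} (r , c) with suc (toℕ r) <? suc k
... | yes _ = refl
... | no _ = refl

row-U⁻¹ : ∀ {k} (v : Vtx (suc k)) → proj₁ (U⁻¹ v) ≡ prevRow (proj₁ v)
row-U⁻¹ (zero , c) = refl
row-U⁻¹ (suc r , c) = refl

toℕ-prevRow : ∀ {k n} (r : Fin (suc k)) → toℕ r ≡ suc n → toℕ (prevRow r) ≡ n
toℕ-prevRow (suc r) eq = trans (toℕ-inject₁ r) (suc-injective eq)

prevRow-nextRow : ∀ {k} (r : Fin (suc k)) → prevRow (nextRow r) ≡ r
prevRow-nextRow {k} r with suc (toℕ r) <? suc k
... | yes r<k = toℕ-injective (toℕ-prevRow (Fin.fromℕ< r<k) (toℕ-fromℕ< r<k))
... | no r≮k = toℕ-injective (trans (toℕ-fromℕ k) (sym (≤-antisym (≤-pred (toℕ<n r)) (≮⇒≥ (r≮k ∘ s≤s)))))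

nextRow-prevRow : ∀ {k} (r : Fin (suc k)) → nextRow (prevRow r) ≡ r
nextRow-prevRow {k} zero with suc (toℕ (Fin.fromℕ k)) <? suc k
... | yes k<k = contradiction (subst (λ i → suc i < suc k) (toℕ-fromℕ k) k<k) (<-irrefl refl)
... | no _ = refl
nextRow-prevRow {k} (suc r) with suc (toℕ (Fin.inject₁ r)) <? suc k
... | yes r<k = toℕ-injective (trans (toℕ-fromℕ< r<k) (cong suc (toℕ-inject₁ r)))
... | no r≮k = contradiction (subst (λ i → suc i < suc k) (sym (toℕ-inject₁ r)) (toℕ<n (suc r))) r≮k

RowAction : ∀ {k} → List Gen → (Fin (suc k) → Fin (suc k)) → Set
RowAction w f = (∀ r c → proj₁ (wordAct w (r , c)) ≡ f r) × (∀ r → f (nextRow r) ≡ nextRow (f r))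

rowAction : ∀ {k} (w : List Gen) → ∃ (RowAction {k} w)
rowAction [] = (λ r → r) , (λ r c → refl) , (λ r → refl)
rowAction (g ∷ w) with rowAction w
... | f , on-rows , commutes = extend g
  where
  extend : (g : Gen) → ∃ (RowAction (g ∷ w))
  extend gU = nextRow ∘ f ,
    (λ r c → trans (row-U (wordAct w (r , c))) (cong nextRow (on-rows r c))) ,
    (λ r → cong nextRow (commutes r))
  extend gU⁻¹ = prevRow ∘ f ,
    (λ r c → trans (row-U⁻¹ (wordAct w (r , c))) (cong prevRow (on-rows r c))) ,
    (λ r → trans (cong prevRow (commutes r)) (trans (prevRow-nextRow (f r)) (sym (nextRow-prevRow (f r)))))
  extend gH = f , on-rows , commutes
  extend gF = f , on-rows , commutes

equivariant-fixing-zero⇒id : ∀ {k} (f : Fin (suc k) → Fin (suc k)) →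
  (∀ r → f (nextRow r) ≡ nextRow (f r)) → f zero ≡ zero → ∀ r → f r ≡ r
equivariant-fixing-zero⇒id f commutes f0≡0 r = by-index (toℕ r) r refl
  where
  by-index : ∀ n r → toℕ r ≡ n → f r ≡ r
  by-index zero zero _ = f0≡0
  by-index (suc n) r r≡1+n = begin
    f r                     ≡⟨ cong f (nextRow-prevRow r) ⟨
    f (nextRow (prevRow r)) ≡⟨ commutes (prevRow r) ⟩
    nextRow (f (prevRow r)) ≡⟨ cong nextRow (by-index n (prevRow r) (toℕ-prevRow r r≡1+n)) ⟩
    nextRow (prevRow r)     ≡⟨ nextRow-prevRow r ⟩
    r                       ∎
    where open ≡-Reasoning

-- Face sums of two complementary rows

module FaceSums {M : ℕ} {z w : Fin 6 → ℕ}
    (z-compl : ∀ c → z c + z (flipCol c) ≡ M)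
    (w-compl : ∀ c → w c + w (flipCol c) ≡ M)
    (sum₂₁ : z 2F + z 1F ≡ w 2F + w 1F)
    (sum₁₀ : z 1F + z 0F ≡ w 1F + w 0F) where

  private
    pair-sums-with-mirror : ∀ (x : Fin 6 → ℕ) → (∀ c → x c + x (flipCol c) ≡ M) →
      ∀ i j → x (flipCol i) + x (flipCol j) + (x i + x j) ≡ M + M
    pair-sums-with-mirror x compl i j = begin
      x (flipCol i) + x (flipCol j) + (x i + x j)  ≡⟨ +-comm (x (flipCol i) + x (flipCol j)) (x i + x j) ⟩
      x i + x j + (x (flipCol i) + x (flipCol j))  ≡⟨ +-interchange (x i) (x j) (x (flipCol i)) (x (flipCol j)) ⟩
      x i + x (flipCol i) + (x j + x (flipCol j))  ≡⟨ cong₂ _+_ (compl i) (compl j) ⟩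
      M + M                                        ∎
      where open ≡-Reasoning

    mirrored : ∀ {i j} → z i + z j ≡ w i + w j → z (flipCol i) + z (flipCol j) ≡ w (flipCol i) + w (flipCol j)
    mirrored {i} {j} eq = +-cancelʳ-≡ (z i + z j) (z (flipCol i) + z (flipCol j)) (w (flipCol i) + w (flipCol j)) (begin
      z (flipCol i) + z (flipCol j) + (z i + z j)  ≡⟨ pair-sums-with-mirror z z-compl i j ⟩
      M + M                                        ≡⟨ pair-sums-with-mirror w w-compl i j ⟨
      w (flipCol i) + w (flipCol j) + (w i + w j)  ≡⟨ cong (w (flipCol i) + w (flipCol j) +_) eq ⟨
      w (flipCol i) + w (flipCol j) + (z i + z j)  ∎)
      where open ≡-Reasoning

    swapped : ∀ i j → z i + z j ≡ w i + w j → z j + z i ≡ w j + w i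
    swapped i j eq = trans (+-comm (z j) (z i)) (trans eq (+-comm (w i) (w j)))

  consecutive-sums : ∀ c → z c + z (nextCol c) ≡ w c + w (nextCol c)
  consecutive-sums 0F = swapped 1F 0F sum₁₀
  consecutive-sums 1F = swapped 2F 1F sum₂₁
  consecutive-sums 2F = trans (z-compl 2F) (sym (w-compl 2F))
  consecutive-sums 3F = mirrored {2F} {1F} sum₂₁
  consecutive-sums 4F = mirrored {1F} {0F} sum₁₀
  consecutive-sums 5F = swapped 0F 5F (trans (z-compl 0F) (sym (w-compl 0F)))

  face-sum : ∀ c → z c + z (nextCol c) + w (flipCol c) + w (flipCol (nextCol c)) ≡ M + M
  face-sum c = begin
    z c + z c' + w (flipCol c) + w (flipCol c')     ≡⟨ +-assoc (z c + z c') (w (flipCol c)) (w (flipCol c')) ⟩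
    z c + z c' + (w (flipCol c) + w (flipCol c'))   ≡⟨ cong (_+ (w (flipCol c) + w (flipCol c'))) (consecutive-sums c) ⟩
    w c + w c' + (w (flipCol c) + w (flipCol c'))   ≡⟨ +-interchange (w c) (w c') (w (flipCol c)) (w (flipCol c')) ⟩
    w c + w (flipCol c) + (w c' + w (flipCol c'))   ≡⟨ cong₂ _+_ (w-compl c) (w-compl c') ⟩
    M + M                                           ∎
    where
    open ≡-Reasoning
    c' : Fin 6
    c' = nextCol c

isEven : ℕ → Bool
isEven zero = true
isEven (suc zero) = false
isEven (suc (suc n)) = isEven n

isEven-suc : ∀ n → isEven (suc n) ≡ not (isEven n)
isEven-suc zero = refl
isEven-suc (suc zero) = refl
isEven-suc (suc (suc n)) = isEven-suc n

isEven-double : ∀ h → isEven (2 * h) ≡ true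
isEven-double zero = refl
isEven-double (suc h) = trans (cong isEven (*-suc 2 h)) (isEven-double h)

isEven⇒EvenN : ∀ n → isEven n ≡ true → EvenN n
isEven⇒EvenN zero _ = ev0
isEven⇒EvenN (suc (suc n)) e = ev2 (isEven⇒EvenN n e)

isOdd⇒OddN : ∀ n → isEven n ≡ false → OddN n
isOdd⇒OddN (suc zero) _ = od1
isOdd⇒OddN (suc (suc n)) e = od2 (isOdd⇒OddN n e)

EvenN⇒isEven : ∀ {n} → EvenN n → isEven n ≡ true
EvenN⇒isEven ev0 = refl
EvenN⇒isEven (ev2 e) = EvenN⇒isEven e

OddN⇒isOdd : ∀ {n} → OddN n → isEven n ≡ false
OddN⇒isOdd od1 = refl
OddN⇒isOdd (od2 o) = OddN⇒isOdd o

orient : Bool → Fin 6 → Fin 6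
orient true c = c
orient false c = flipCol c

orient-involutive : ∀ e c → orient e (orient e c) ≡ c
orient-involutive true c = refl
orient-involutive false 0F = refl
orient-involutive false 1F = refl
orient-involutive false 2F = refl
orient-involutive false 3F = refl
orient-involutive false 4F = refl
orient-involutive false 5F = refl

orient-injective : ∀ e {c c'} → orient e c ≡ orient e c' → c ≡ c'
orient-injective e {c} {c'} eq = trans (sym (orient-involutive e c)) (trans (cong (orient e) eq) (orient-involutive e c'))

rowOrientation : ∀ {m} → Fin m → Bool
rowOrientation r = isEven (toℕ r)

column : Fin 3 → Fin 6
column i = i Fin.↑ˡ 3

column≢flipCol-column : ∀ i j → column i ≢ flipCol (column j)
column≢flipCol-column 0F 0F ()
column≢flipCol-column 0F 1F ()
column≢flipCol-column 0F 2F ()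
column≢flipCol-column 1F 0F ()
column≢flipCol-column 1F 1F ()
column≢flipCol-column 1F 2F ()
column≢flipCol-column 2F 0F ()
column≢flipCol-column 2F 1F ()
column≢flipCol-column 2F 2F ()

column-injective : ∀ {i j} → column i ≡ column j → i ≡ j
column-injective {i} {j} = FinProps.↑ˡ-injective 3 i j

data PathStep : Fin 3 → Fin 3 → Set where
  step₀₁ : PathStep 0F 1F
  step₁₂ : PathStep 1F 2F

PathStep-irreflexive : ∀ {i} → ¬ PathStep i i
PathStep-irreflexive ()

column-or-flipCol-column : ∀ c → ∃ λ i → c ≡ column i ⊎ c ≡ flipCol (column i)
column-or-flipCol-column 0F = 0F , inj₁ refl
column-or-flipCol-column 1F = 1F , inj₁ refl
column-or-flipCol-column 2F = 2F , inj₁ refl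
column-or-flipCol-column 3F = 2F , inj₂ refl
column-or-flipCol-column 4F = 1F , inj₂ refl
column-or-flipCol-column 5F = 0F , inj₂ refl

LPair-step : ∀ {m} (r : Fin m) {i j} → PathStep i j →
  LPair r (orient (rowOrientation r) (column i)) (orient (rowOrientation r) (column j))
LPair-step r s with isEven (toℕ r) in e
LPair-step r step₀₁ | true = inj₁ (isEven⇒EvenN _ e , inj₁ (refl , refl))
LPair-step r step₁₂ | true = inj₁ (isEven⇒EvenN _ e , inj₂ (refl , refl))
LPair-step r step₀₁ | false = inj₂ (isOdd⇒OddN _ e , inj₁ (refl , refl))
LPair-step r step₁₂ | false = inj₂ (isOdd⇒OddN _ e , inj₂ (refl , refl))

LPair⇒step : ∀ {m} {r : Fin m} {c c'} → LPair r c c' →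
  ∃₂ λ i j → PathStep i j × c ≡ orient (rowOrientation r) (column i) × c' ≡ orient (rowOrientation r) (column j)
LPair⇒step (inj₁ (ev , cols)) rewrite EvenN⇒isEven ev = even-columns cols
  where
  even-columns : ∀ {c c'} → (toℕ c ≡ 0 × toℕ c' ≡ 1) ⊎ (toℕ c ≡ 1 × toℕ c' ≡ 2) →
    ∃₂ λ i j → PathStep i j × c ≡ column i × c' ≡ column j
  even-columns (inj₁ (c≡ , c'≡)) = 0F , 1F , step₀₁ , toℕ-injective c≡ , toℕ-injective c'≡
  even-columns (inj₂ (c≡ , c'≡)) = 1F , 2F , step₁₂ , toℕ-injective c≡ , toℕ-injective c'≡
LPair⇒step (inj₂ (od , cols)) rewrite OddN⇒isOdd od = odd-columns cols
  where
  odd-columns : ∀ {c c'} → (toℕ c ≡ 5 × toℕ c' ≡ 4) ⊎ (toℕ c ≡ 4 × toℕ c' ≡ 3) →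
    ∃₂ λ i j → PathStep i j × c ≡ flipCol (column i) × c' ≡ flipCol (column j)
  odd-columns (inj₁ (c≡ , c'≡)) = 0F , 1F , step₀₁ , toℕ-injective c≡ , toℕ-injective c'≡
  odd-columns (inj₂ (c≡ , c'≡)) = 1F , 2F , step₁₂ , toℕ-injective c≡ , toℕ-injective c'≡

-- Vertices of G(6m, b)

GAdj-sym : ∀ {m a₁ a₂ u v} → GAdj m a₁ a₂ u v → GAdj m a₁ a₂ v u
GAdj-sym (u∈ , v∈ , u≢v , z₁ , z₂ , z₁∈u , z₂∈v , sum) =
  v∈ , u∈ , u≢v ∘ sym , z₂ , z₁ , z₂∈v , z₁∈u , Sum.map (trans (+-comm z₂ z₁)) (trans (+-comm z₂ z₁)) sum

module Labels (m : ℕ) where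

  IsLabel : ℕ → Set
  IsLabel x = 1 ≤ x × x ≤ 6 * m

  partner : ℕ → ℕ
  partner x = suc (6 * m) ∸ x

  -- the vertex {x, partner x}, represented as in Defs by its element in 1..3m
  vertexOf : ℕ → ℕ
  vertexOf x with x ≤? 3 * m
  ... | yes _ = x
  ... | no _ = partner x

  vertexOf-≤ : ∀ {x} → x ≤ 3 * m → vertexOf x ≡ x
  vertexOf-≤ {x} x≤3m with x ≤? 3 * m
  ... | yes _ = refl
  ... | no x≰3m = contradiction x≤3m x≰3m

  vertexOf-> : ∀ {x} → 3 * m < x → vertexOf x ≡ partner x
  vertexOf-> {x} 3m<x with x ≤? 3 * m
  ... | yes x≤3m = contradiction x≤3m (<⇒≱ 3m<x)
  ... | no _ = refl

  6m≡3m+3m : 6 * m ≡ 3 * m + 3 * m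
  6m≡3m+3m = solve (m ∷ [])

  3m≤6m : 3 * m ≤ 6 * m
  3m≤6m = subst (3 * m ≤_) (sym 6m≡3m+3m) (m≤m+n (3 * m) (3 * m))

  +-partner : ∀ {x} → IsLabel x → x + partner x ≡ suc (6 * m)
  +-partner (_ , x≤6m) = m+[n∸m]≡n (m≤n⇒m≤1+n x≤6m)

  partner-involutive : ∀ {x} → IsLabel x → partner (partner x) ≡ x
  partner-involutive (_ , x≤6m) = m∸[m∸n]≡n (m≤n⇒m≤1+n x≤6m)

  partner-isLabel : ∀ {x} → IsLabel x → IsLabel (partner x)
  partner-isLabel (1≤x , x≤6m) = m<n⇒0<n∸m (s≤s x≤6m) , ∸-monoʳ-≤ (suc (6 * m)) 1≤x

  partner-≤ : ∀ {x} → 3 * m < x → partner x ≤ 3 * m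
  partner-≤ 3m<x = ≤-trans (∸-monoʳ-≤ (suc (6 * m)) 3m<x)
                      (≤-reflexive (trans (cong (_∸ 3 * m) 6m≡3m+3m) (m+n∸m≡n (3 * m) (3 * m))))

  partner-> : ∀ {x} → x ≤ 3 * m → 3 * m < partner x
  partner-> {x} x≤3m = ≤-trans (≤-reflexive (sym suc6m∸3m)) (∸-monoʳ-≤ (suc (6 * m)) x≤3m)
    where
    suc6m∸3m : suc (6 * m) ∸ 3 * m ≡ suc (3 * m)
    suc6m∸3m = begin
      suc (6 * m) ∸ 3 * m            ≡⟨ cong (λ y → suc y ∸ 3 * m) 6m≡3m+3m ⟩
      suc (3 * m + 3 * m) ∸ 3 * m    ≡⟨ cong (_∸ 3 * m) (+-suc (3 * m) (3 * m)) ⟨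
      3 * m + suc (3 * m) ∸ 3 * m    ≡⟨ m+n∸m≡n (3 * m) (suc (3 * m)) ⟩
      suc (3 * m)                    ∎
      where open ≡-Reasoning

  vertexOf-isGVertex : ∀ {x} → IsLabel x → IsGVertex m (vertexOf x)
  vertexOf-isGVertex {x} x∈ with x ≤? 3 * m
  ... | yes x≤3m = proj₁ x∈ , x≤3m
  ... | no x≰3m = proj₁ (partner-isLabel x∈) , partner-≤ (≰⇒> x≰3m)

  vertexOf-partner : ∀ {x} → IsLabel x → vertexOf (partner x) ≡ vertexOf x
  vertexOf-partner {x} x∈ with x ≤? 3 * m
  ... | yes x≤3m = trans (vertexOf-> (partner-> x≤3m)) (partner-involutive x∈)
  ... | no x≰3m = vertexOf-≤ (partner-≤ (≰⇒> x≰3m))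

  vertexOf-injective : ∀ {x y} → IsLabel x → IsLabel y → vertexOf x ≡ vertexOf y → x ≡ y ⊎ x ≡ partner y
  vertexOf-injective {x} {y} x∈ y∈ vx≡vy with ≤-<-connex x (3 * m) | ≤-<-connex y (3 * m)
  ... | inj₁ x≤ | inj₁ y≤ = inj₁ (trans (sym (vertexOf-≤ x≤)) (trans vx≡vy (vertexOf-≤ y≤)))
  ... | inj₁ x≤ | inj₂ y> = inj₂ (trans (sym (vertexOf-≤ x≤)) (trans vx≡vy (vertexOf-> y>)))
  ... | inj₂ x> | inj₁ y≤ = inj₂ (begin
    x                      ≡⟨ partner-involutive x∈ ⟨
    partner (partner x)    ≡⟨ cong partner (trans (sym (vertexOf-> x>)) (trans vx≡vy (vertexOf-≤ y≤))) ⟩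
    partner y              ∎)
    where open ≡-Reasoning
  ... | inj₂ x> | inj₂ y> = inj₁ (begin
    x                      ≡⟨ partner-involutive x∈ ⟨
    partner (partner x)    ≡⟨ cong partner (trans (sym (vertexOf-> x>)) (trans vx≡vy (vertexOf-> y>))) ⟩
    partner (partner y)    ≡⟨ partner-involutive y∈ ⟩
    y                      ∎)
    where open ≡-Reasoning

  vertexOf-mem : ∀ {z} → IsLabel z → Mem m (vertexOf z) z
  vertexOf-mem {z} z∈ with ≤-<-connex z (3 * m)
  ... | inj₁ z≤ = inj₁ (sym (vertexOf-≤ z≤))
  ... | inj₂ z> = inj₂ (trans (cong (z +_) (vertexOf-> z>)) (+-partner z∈))

  mem⇒vertexOf : ∀ {u z} → IsGVertex m u → Mem m u z → u ≡ vertexOf z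
  mem⇒vertexOf (_ , u≤3m) (inj₁ refl) = sym (vertexOf-≤ u≤3m)
  mem⇒vertexOf {u} {z} (1≤u , u≤3m) (inj₂ z+u≡) = begin
    u                      ≡⟨ partner-involutive (1≤u , ≤-trans u≤3m 3m≤6m) ⟨
    partner (partner u)    ≡⟨ cong partner z≡partner-u ⟨
    partner z              ≡⟨ vertexOf-> (subst (3 * m <_) (sym z≡partner-u) (partner-> u≤3m)) ⟨
    vertexOf z             ∎
    where
    open ≡-Reasoning
    z≡partner-u : z ≡ partner u
    z≡partner-u = sym (trans (cong (_∸ u) (sym z+u≡)) (m+n∸n≡m z u))

  mirroredRow : ℕ → ℕ → ℕ → Fin 6 → ℕ
  mirroredRow a₀ a₁ a₂ 0F = a₀
  mirroredRow a₀ a₁ a₂ 1F = a₁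
  mirroredRow a₀ a₁ a₂ 2F = a₂
  mirroredRow a₀ a₁ a₂ 3F = partner a₂
  mirroredRow a₀ a₁ a₂ 4F = partner a₁
  mirroredRow a₀ a₁ a₂ 5F = partner a₀

  module _ {a₀ a₁ a₂} (a₀∈ : IsLabel a₀) (a₁∈ : IsLabel a₁) (a₂∈ : IsLabel a₂) where

    mirroredRow-isLabel : ∀ c → IsLabel (mirroredRow a₀ a₁ a₂ c)
    mirroredRow-isLabel 0F = a₀∈
    mirroredRow-isLabel 1F = a₁∈
    mirroredRow-isLabel 2F = a₂∈
    mirroredRow-isLabel 3F = partner-isLabel a₂∈
    mirroredRow-isLabel 4F = partner-isLabel a₁∈
    mirroredRow-isLabel 5F = partner-isLabel a₀∈

    mirroredRow-complementary : ∀ c → mirroredRow a₀ a₁ a₂ c + mirroredRow a₀ a₁ a₂ (flipCol c) ≡ suc (6 * m)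
    mirroredRow-complementary 0F = +-partner a₀∈
    mirroredRow-complementary 1F = +-partner a₁∈
    mirroredRow-complementary 2F = +-partner a₂∈
    mirroredRow-complementary 3F = trans (+-comm (partner a₂) a₂) (+-partner a₂∈)
    mirroredRow-complementary 4F = trans (+-comm (partner a₁) a₁) (+-partner a₁∈)
    mirroredRow-complementary 5F = trans (+-comm (partner a₀) a₀) (+-partner a₀∈)

-- Covering the vertices of G(6m, b) by m paths

module Covering (m E : ℕ) (E≤1+m : E ≤ suc m) where
  open Labels m

  -- 2k + 1 for k < E and 3k + 2 − E from k = E on
  mid : ℕ → ℕ
  mid k = suc (2 * k + (suc k ∸ E))

  far : ℕ → ℕ
  far k = 3 * m + E ∸ mid k

  mid-below : ∀ {k} → k < E → mid k ≡ suc (k * 2)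
  mid-below {k} k<E = begin
    suc (2 * k + (suc k ∸ E))   ≡⟨ cong (λ y → suc (2 * k + y)) (m≤n⇒m∸n≡0 k<E) ⟩
    suc (2 * k + 0)             ≡⟨ solve (k ∷ []) ⟩
    suc (k * 2)                 ∎
    where open ≡-Reasoning

  mid-above : ∀ j → mid (E + j) ≡ suc (2 * E) + suc (j * 3)
  mid-above j = begin
    suc (2 * (E + j) + (suc (E + j) ∸ E))   ≡⟨ cong (λ y → suc (2 * (E + j) + (y ∸ E))) (+-suc E j) ⟨
    suc (2 * (E + j) + (E + suc j ∸ E))     ≡⟨ cong (λ y → suc (2 * (E + j) + y)) (m+n∸m≡n E (suc j)) ⟩
    suc (2 * (E + j) + suc j)               ≡⟨ solve (E ∷ j ∷ []) ⟩
    suc (2 * E) + suc (j * 3)               ∎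
    where open ≡-Reasoning

  1+mid≤3m : ∀ {k} → k < m → suc (mid k) ≤ 3 * m
  1+mid≤3m {k} k<m = begin
    suc (mid k)                    ≤⟨ s≤s (s≤s (+-monoʳ-≤ (2 * k) (m∸n≤m (suc k) E))) ⟩
    suc (suc (2 * k + suc k))      ≡⟨ solve (k ∷ []) ⟩
    3 * suc k                      ≤⟨ *-monoʳ-≤ 3 k<m ⟩
    3 * m                          ∎
    where open ≤-Reasoning

  mid+far : ∀ {k} → k < m → mid k + far k ≡ 3 * m + E
  mid+far k<m = m+[n∸m]≡n (≤-trans (n≤1+n _) (≤-trans (1+mid≤3m k<m) (m≤m+n (3 * m) E)))

  CoveredBy : ℕ → ℕ → Set
  CoveredBy q k = q ≡ mid k ⊎ q ≡ suc (mid k) ⊎ q ≡ vertexOf (far k)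

  Covered : ℕ → Set
  Covered q = ∃ λ k → k < m × CoveredBy q k

  far-covered : ∀ {q k} → k < m → q ≤ 3 * m → 3 * m + E ≡ mid k + q → Covered q
  far-covered {q} {k} k<m q≤3m 3m+E≡ = k , k<m , inj₂ (inj₂ (begin
    q                   ≡⟨ vertexOf-≤ q≤3m ⟨
    vertexOf q          ≡⟨ cong vertexOf (trans (cong (_∸ mid k) 3m+E≡) (m+n∸m≡n (mid k) q)) ⟨
    vertexOf (far k)    ∎))
    where open ≡-Reasoning

  covered-low : ∀ q → 1 ≤ q → q ≤ 2 * E → q ≤ 2 * m → Covered q
  covered-low (suc q) _ 1+q≤2E 1+q≤2m with q divMod 2
  ... | result x 0F refl = x , m*2<2*n⇒m<n 1+q≤2m , inj₁ (sym (mid-below (m*2<2*n⇒m<n 1+q≤2E)))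
  ... | result x 1F refl = x , m*2<2*n⇒m<n (<⇒≤ 1+q≤2m) ,
                           inj₂ (inj₁ (cong suc (sym (mid-below (m*2<2*n⇒m<n (<⇒≤ 1+q≤2E))))))

  E+j<m : ∀ j ρ → suc (2 * E) + (ρ + j * 3) + E ≤ 3 * m → E + j < m
  E+j<m j ρ q+E≤3m = *-cancelˡ-< 3 (E + j) m (begin-strict
    3 * (E + j)                      <⟨ n<1+n _ ⟩
    suc (3 * (E + j))                ≤⟨ m≤m+n _ ρ ⟩
    suc (3 * (E + j)) + ρ            ≡⟨ solve (E ∷ j ∷ ρ ∷ []) ⟩
    suc (2 * E) + (ρ + j * 3) + E    ≤⟨ q+E≤3m ⟩
    3 * m                            ∎)
    where open ≤-Reasoning

  covered-middle-far : ∀ j → suc (2 * E) + j * 3 + E ≤ 3 * m → Covered (suc (2 * E) + j * 3)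
  covered-middle-far j q+E≤3m with m≤n⇒∃[o]m+o≡n (E+j<m j 0 q+E≤3m)
  ... | j' , 1+E+j+j'≡m = far-covered (subst (suc (E + j') ≤_) 1+E+j'+j≡m (m≤m+n _ j)) (≤-trans (m≤m+n _ E) q+E≤3m) 3m+E≡
    where
    open ≡-Reasoning
    1+E+j'+j≡m : suc (E + j') + j ≡ m
    1+E+j'+j≡m = begin
      suc (E + j') + j   ≡⟨ solve (E ∷ j ∷ j' ∷ []) ⟩
      suc (E + j) + j'   ≡⟨ 1+E+j+j'≡m ⟩
      m                  ∎
    3m+E≡ : 3 * m + E ≡ mid (E + j') + (suc (2 * E) + j * 3)
    3m+E≡ = begin
      3 * m + E                                        ≡⟨ cong (λ y → 3 * y + E) 1+E+j+j'≡m ⟨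
      3 * (suc (E + j) + j') + E                       ≡⟨ solve (E ∷ j ∷ j' ∷ []) ⟩
      suc (2 * E) + suc (j' * 3) + (suc (2 * E) + j * 3) ≡⟨ cong (_+ (suc (2 * E) + j * 3)) (mid-above j') ⟨
      mid (E + j') + (suc (2 * E) + j * 3)             ∎

  covered-middle : ∀ q → 2 * E < q → q + E ≤ 3 * m → Covered q
  covered-middle q 2E<q q+E≤3m with m≤n⇒∃[o]m+o≡n 2E<q
  ... | x , refl with x divMod 3
  ... | result j 0F refl = covered-middle-far j q+E≤3m
  ... | result j 1F refl = E + j , E+j<m j 1 q+E≤3m , inj₁ (sym (mid-above j))
  ... | result j 2F refl = E + j , E+j<m j 2 q+E≤3m ,
                           inj₂ (inj₁ (trans (+-suc (suc (2 * E)) (suc (j * 3))) (cong suc (sym (mid-above j)))))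

  covered-high-even : ∀ {q d i} → q + d ≡ 3 * m → E ≡ suc (d + i * 2) → d < m → Covered q
  covered-high-even {q} {d} {i} q+d≡3m E≡ d<m = far-covered k<m (subst (q ≤_) q+d≡3m (m≤m+n q d)) (begin-equality
    3 * m + E                  ≡⟨ cong₂ _+_ (sym q+d≡3m) E≡ ⟩
    q + d + suc (d + i * 2)    ≡⟨ solve (q ∷ d ∷ i ∷ []) ⟩
    suc ((d + i) * 2) + q      ≡⟨ cong (_+ q) (mid-below k<E) ⟨
    mid (d + i) + q            ∎)
    where
    open ≤-Reasoning
    k<E : d + i < E
    k<E = subst (d + i <_) (sym E≡) (s≤s (begin
      d + i          ≤⟨ m≤m+n (d + i) i ⟩
      d + i + i      ≡⟨ solve (d ∷ i ∷ []) ⟩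
      d + i * 2      ∎))
    k<m : d + i < m
    k<m = *-cancelˡ-< 2 (d + i) m (begin-strict
      2 * (d + i)          ≡⟨ solve (d ∷ i ∷ []) ⟩
      d + (d + i * 2)      <⟨ +-mono-<-≤ d<m (≤-pred (subst (_≤ suc m) E≡ E≤1+m)) ⟩
      m + m                ≡⟨ solve (m ∷ []) ⟩
      2 * m                ∎)

  covered-high-odd : ∀ {q d i} → q + d ≡ 3 * m → E ≡ suc (d + suc (i * 2)) → Covered q
  covered-high-odd {q} {d} {i} q+d≡3m E≡ = i , i<m , inj₂ (inj₂ (begin-equality
    q                                  ≡⟨ m+n∸m≡n (3 * m + d) q ⟨
    3 * m + d + q ∸ (3 * m + d)        ≡⟨ cong (_∸ (3 * m + d)) 3m+d+q≡6m ⟩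
    partner (suc (3 * m + d))          ≡⟨ vertexOf-> (s≤s (m≤m+n (3 * m) d)) ⟨
    vertexOf (suc (3 * m + d))         ≡⟨ cong vertexOf (trans (cong (_∸ mid i) 3m+E≡) (m+n∸m≡n (mid i) _)) ⟨
    vertexOf (far i)                   ∎))
    where
    open ≤-Reasoning
    i<E : i < E
    i<E = subst (i <_) (sym E≡) (s≤s (begin
      i                  ≤⟨ m≤n+m i (d + suc i) ⟩
      d + suc i + i      ≡⟨ solve (d ∷ i ∷ []) ⟩
      d + suc (i * 2)    ∎))
    i<m : i < m
    i<m = begin-strict
      i                  <⟨ s≤s (m≤n+m i (d + i)) ⟩
      suc (d + i + i)    ≡⟨ solve (d ∷ i ∷ []) ⟩
      d + suc (i * 2)    ≤⟨ ≤-pred (subst (_≤ suc m) E≡ E≤1+m) ⟩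
      m                  ∎
    3m+d+q≡6m : 3 * m + d + q ≡ 6 * m
    3m+d+q≡6m = begin-equality
      3 * m + d + q      ≡⟨ solve (m ∷ d ∷ q ∷ []) ⟩
      3 * m + (q + d)    ≡⟨ cong (3 * m +_) q+d≡3m ⟩
      3 * m + 3 * m      ≡⟨ 6m≡3m+3m ⟨
      6 * m              ∎
    3m+E≡ : 3 * m + E ≡ mid i + suc (3 * m + d)
    3m+E≡ = begin-equality
      3 * m + E                          ≡⟨ cong (3 * m +_) E≡ ⟩
      3 * m + suc (d + suc (i * 2))      ≡⟨ solve (m ∷ d ∷ i ∷ []) ⟩
      suc (i * 2) + suc (3 * m + d)      ≡⟨ cong (_+ suc (3 * m + d)) (mid-below i<E) ⟨
      mid i + suc (3 * m + d)            ∎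

  covered-high : ∀ q → q ≤ 3 * m → 3 * m < q + E → 2 * m < q ⊎ 2 * E < q → Covered q
  covered-high q q≤3m 3m<q+E q-large with m≤n⇒∃[o]m+o≡n q≤3m | m≤n⇒∃[o]m+o≡n 3m<q+E
  ... | d , q+d≡3m | v , 1+3m+v≡q+E = by-parity (v divMod 2) E≡1+d+v
    where
    open ≤-Reasoning
    E≡1+d+v : E ≡ suc (d + v)
    E≡1+d+v = +-cancelˡ-≡ q E (suc (d + v)) (begin-equality
      q + E              ≡⟨ 1+3m+v≡q+E ⟨
      suc (3 * m) + v    ≡⟨ cong (λ y → suc y + v) q+d≡3m ⟨
      suc (q + d) + v    ≡⟨ solve (q ∷ d ∷ v ∷ []) ⟩
      q + suc (d + v)    ∎)
    d<E : d < E
    d<E = subst (d <_) (sym E≡1+d+v) (s≤s (m≤m+n d v))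
    d<m : 2 * m < q ⊎ 2 * E < q → d < m
    d<m (inj₁ 2m<q) = +-cancelˡ-< (2 * m) d m (begin-strict
      2 * m + d    <⟨ +-monoˡ-< d 2m<q ⟩
      q + d        ≡⟨ q+d≡3m ⟩
      3 * m        ≡⟨ solve (m ∷ []) ⟩
      2 * m + m    ∎)
    d<m (inj₂ 2E<q) = *-cancelˡ-< 3 d m (begin-strict
      3 * d        ≡⟨ solve (d ∷ []) ⟩
      2 * d + d    <⟨ +-monoˡ-< d (*-monoʳ-< 2 d<E) ⟩
      2 * E + d    <⟨ +-monoˡ-< d 2E<q ⟩
      q + d        ≡⟨ q+d≡3m ⟩
      3 * m        ∎)
    by-parity : ∀ {v} → DivMod v 2 → E ≡ suc (d + v) → Covered q
    by-parity (result i 0F refl) E≡ = covered-high-even {i = i} q+d≡3m E≡ (d<m q-large)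
    by-parity (result i 1F refl) E≡ = covered-high-odd {i = i} q+d≡3m E≡

  large⇒2E<q : ∀ {q} → 2 * m < q ⊎ 2 * E < q → q + E ≤ 3 * m → 2 * E < q
  large⇒2E<q (inj₂ 2E<q) _ = 2E<q
  large⇒2E<q {q} (inj₁ 2m<q) q+E≤3m = <-trans (*-monoʳ-< 2 E<m) 2m<q
    where
    open ≤-Reasoning
    E<m : E < m
    E<m = +-cancelˡ-< (2 * m) E m (begin-strict
      2 * m + E    <⟨ +-monoˡ-< E 2m<q ⟩
      q + E        ≤⟨ q+E≤3m ⟩
      3 * m        ≡⟨ solve (m ∷ []) ⟩
      2 * m + m    ∎)

  covered-beyond : ∀ q → q ≤ 3 * m → 2 * m < q ⊎ 2 * E < q → Covered q
  covered-beyond q q≤3m q-large with ≤-<-connex (q + E) (3 * m)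
  ... | inj₁ q+E≤3m = covered-middle q (large⇒2E<q q-large q+E≤3m) q+E≤3m
  ... | inj₂ 3m<q+E = covered-high q q≤3m 3m<q+E q-large

  covered : ∀ q → 1 ≤ q → q ≤ 3 * m → Covered q
  covered q 1≤q q≤3m with q ≤? 2 * E | q ≤? 2 * m
  ... | yes q≤2E | yes q≤2m = covered-low q 1≤q q≤2E q≤2m
  ... | yes _    | no q≰2m  = covered-beyond q q≤3m (inj₁ (≰⇒> q≰2m))
  ... | no q≰2E  | _        = covered-beyond q q≤3m (inj₂ (≰⇒> q≰2E))

data Range (m b E : ℕ) : Set where
  lower : b ≡ 3 * m + E → Range m b E
  upper : b + E ≡ suc (9 * m) → Range m b E

range-parameter : ∀ m b → (3 * m + 1 ≤ b × b ≤ 4 * m + 1) ⊎ (8 * m ≤ b × b ≤ 9 * m + 1) →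
  ∃ λ E → E ≤ suc m × Range m b E
range-parameter m b (inj₁ (lo , hi)) with m≤n⇒∃[o]m+o≡n lo
... | s , refl = suc s , s≤s s≤m , lower (solve (m ∷ s ∷ []))
  where
  s≤m : s ≤ m
  s≤m = +-cancelˡ-≤ (3 * m + 1) s m (≤-trans hi (≤-reflexive (solve (m ∷ []))))
range-parameter m b (inj₂ (lo , hi)) with m≤n⇒∃[o]m+o≡n lo
... | s , refl with m≤n⇒∃[o]m+o≡n hi
... | E , b+E≡ = E , E≤1+m , upper (trans b+E≡ (+-comm (9 * m) 1))
  where
  E≤1+m : E ≤ suc m
  E≤1+m = subst (E ≤_) (+-cancelˡ-≡ (8 * m) (s + E) (suc m) (begin
    8 * m + (s + E)    ≡⟨ +-assoc (8 * m) s E ⟨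
    8 * m + s + E      ≡⟨ b+E≡ ⟩
    9 * m + 1          ≡⟨ solve (m ∷ []) ⟩
    8 * m + suc m      ∎)) (m≤n+m E s)
    where open ≡-Reasoning

module Construction (m E b : ℕ) (E≤1+m : E ≤ suc m) (range : Range m b E) where
  open Labels m
  open Covering m E E≤1+m

  module _ {k} (k<m : k < m) where

    mid-isLabel : IsLabel (mid k)
    mid-isLabel = s≤s z≤n , ≤-trans (≤-trans (n≤1+n _) (1+mid≤3m k<m)) 3m≤6m

    1+mid-isLabel : IsLabel (suc (mid k))
    1+mid-isLabel = s≤s z≤n , ≤-trans (1+mid≤3m k<m) 3m≤6m

    far-isLabel : IsLabel (far k)
    far-isLabel = m<n⇒0<n∸m (≤-trans (1+mid≤3m k<m) (m≤m+n (3 * m) E)) , ≤-pred (begin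
      suc (far k)            ≤⟨ +-monoˡ-≤ (far k) (s≤s z≤n) ⟩
      mid k + far k          ≡⟨ mid+far k<m ⟩
      3 * m + E              ≤⟨ +-monoʳ-≤ (3 * m) E≤1+m ⟩
      3 * m + suc m          ≤⟨ +-monoʳ-≤ (3 * m) (s≤s (m≤m+n m (2 * m))) ⟩
      3 * m + suc (m + 2 * m) ≡⟨ solve (m ∷ []) ⟩
      suc (6 * m)            ∎)
      where open ≤-Reasoning

  pathLabels : Range m b E → ℕ → Fin 6 → ℕ
  pathLabels (lower _) k = mirroredRow (far k) (mid k) (partner (suc (mid k)))
  pathLabels (upper _) k = mirroredRow (partner (far k)) (partner (suc (mid k))) (mid k)

  lab : Fin m → Fin 6 → ℕ
  lab p = pathLabels range (toℕ p)

  module _ (p : Fin m) where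
    private
      k : ℕ
      k = toℕ p
      k<m : k < m
      k<m = toℕ<n p
      far∈ : IsLabel (far k)
      far∈ = far-isLabel k<m
      mid∈ : IsLabel (mid k)
      mid∈ = mid-isLabel k<m
      1+mid∈ : IsLabel (suc (mid k))
      1+mid∈ = 1+mid-isLabel k<m

    pathLabels-isLabel : ∀ R c → IsLabel (pathLabels R k c)
    pathLabels-isLabel (lower _) = mirroredRow-isLabel far∈ mid∈ (partner-isLabel 1+mid∈)
    pathLabels-isLabel (upper _) = mirroredRow-isLabel (partner-isLabel far∈) (partner-isLabel 1+mid∈) mid∈

    pathLabels-complementary : ∀ R c → pathLabels R k c + pathLabels R k (flipCol c) ≡ suc (6 * m)
    pathLabels-complementary (lower _) = mirroredRow-complementary far∈ mid∈ (partner-isLabel 1+mid∈)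
    pathLabels-complementary (upper _) = mirroredRow-complementary (partner-isLabel far∈) (partner-isLabel 1+mid∈) mid∈

    private
      partner[1+mid]+mid : partner (suc (mid k)) + mid k ≡ 6 * m
      partner[1+mid]+mid = m∸n+n≡m (proj₂ mid∈)

    pathLabels-sum₂₁ : ∀ R → pathLabels R k 2F + pathLabels R k 1F ≡ 6 * m
    pathLabels-sum₂₁ (lower _) = partner[1+mid]+mid
    pathLabels-sum₂₁ (upper _) = trans (+-comm (mid k) (partner (suc (mid k)))) partner[1+mid]+mid

    pathLabels-sum₁₀ : ∀ R → pathLabels R k 1F + pathLabels R k 0F ≡ b
    pathLabels-sum₁₀ (lower b≡) = trans (mid+far k<m) (sym b≡)
    pathLabels-sum₁₀ (upper b+E≡) = +-cancelʳ-≡ (mid k + far k) _ _ (begin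
      partner (suc (mid k)) + partner (far k) + (mid k + far k)  ≡⟨ +-interchange (partner (suc (mid k))) (partner (far k)) _ _ ⟩
      partner (suc (mid k)) + mid k + (partner (far k) + far k)  ≡⟨ cong₂ _+_ partner[1+mid]+mid far+partner ⟩
      6 * m + suc (6 * m)                                        ≡⟨ solve (m ∷ []) ⟩
      suc (9 * m) + 3 * m                                        ≡⟨ cong (_+ 3 * m) b+E≡ ⟨
      b + E + 3 * m                                              ≡⟨ solve (b ∷ E ∷ m ∷ []) ⟩
      b + (3 * m + E)                                            ≡⟨ cong (b +_) (mid+far k<m) ⟨
      b + (mid k + far k)                                        ∎)
      where
      open ≡-Reasoning
      far+partner : partner (far k) + far k ≡ suc (6 * m)
      far+partner = trans (+-comm (partner (far k)) (far k)) (+-partner far∈)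

    pathLabels-cover : ∀ R {q} → CoveredBy q k → ∃ λ c → q ≡ vertexOf (pathLabels R k c)
    pathLabels-cover (lower _) (inj₁ refl) = 1F , sym (vertexOf-≤ (≤-trans (n≤1+n _) (1+mid≤3m k<m)))
    pathLabels-cover (lower _) (inj₂ (inj₁ refl)) = 2F , sym (trans (vertexOf-partner 1+mid∈) (vertexOf-≤ (1+mid≤3m k<m)))
    pathLabels-cover (lower _) (inj₂ (inj₂ refl)) = 0F , refl
    pathLabels-cover (upper _) (inj₁ refl) = 2F , sym (vertexOf-≤ (≤-trans (n≤1+n _) (1+mid≤3m k<m)))
    pathLabels-cover (upper _) (inj₂ (inj₁ refl)) = 1F , sym (trans (vertexOf-partner 1+mid∈) (vertexOf-≤ (1+mid≤3m k<m)))
    pathLabels-cover (upper _) (inj₂ (inj₂ refl)) = 0F , sym (vertexOf-partner far∈)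

    lab-isLabel : ∀ c → IsLabel (lab p c)
    lab-isLabel = pathLabels-isLabel range

    lab-complementary : ∀ c → lab p c + lab p (flipCol c) ≡ suc (6 * m)
    lab-complementary = pathLabels-complementary range

    lab-flipCol : ∀ c → lab p (flipCol c) ≡ partner (lab p c)
    lab-flipCol c = sym (trans (cong (_∸ lab p c) (sym (lab-complementary c))) (m+n∸m≡n (lab p c) _))

    lab-sum₂₁ : lab p 2F + lab p 1F ≡ 6 * m
    lab-sum₂₁ = pathLabels-sum₂₁ range

    lab-sum₁₀ : lab p 1F + lab p 0F ≡ b
    lab-sum₁₀ = pathLabels-sum₁₀ range

  faceSum : ℕ
  faceSum = suc (6 * m) + suc (6 * m)

  face-sum : ∀ p p' c → lab p c + lab p (nextCol c) + lab p' (flipCol c) + lab p' (flipCol (nextCol c)) ≡ faceSum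
  face-sum p p' = FaceSums.face-sum {z = lab p} {w = lab p'} (lab-complementary p) (lab-complementary p')
    (trans (lab-sum₂₁ p) (sym (lab-sum₂₁ p'))) (trans (lab-sum₁₀ p) (sym (lab-sum₁₀ p')))

  lab-surjective : ∀ {x} → IsLabel x → ∃₂ λ p c → lab p c ≡ x
  lab-surjective {x} x∈ with covered (vertexOf x) (proj₁ (vertexOf-isGVertex x∈)) (proj₂ (vertexOf-isGVertex x∈))
  ... | k , k<m , covered-by-k with fromℕ< k<m | toℕ-fromℕ< k<m
  ... | p | refl with pathLabels-cover p range covered-by-k
  ... | c , vx≡ with vertexOf-injective x∈ (lab-isLabel p c) vx≡
  ... | inj₁ x≡ = p , c , sym x≡
  ... | inj₂ x≡partner = p , flipCol c , trans (lab-flipCol p c) (sym x≡partner)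

  private
    pred-label< : ∀ {x} → IsLabel x → x ∸ 1 < m * 6
    pred-label< {x} (1≤x , x≤6m) = subst (x ∸ 1 <_) (*-comm 6 m) (≤-trans (≤-reflexive (m+[n∸m]≡n 1≤x)) x≤6m)

    code : Fin m × Fin 6 → Fin (m * 6)
    code (p , c) = fromℕ< (pred-label< (lab-isLabel p c))

    toℕ-code : ∀ p c → toℕ (code (remQuot 6 (combine p c))) ≡ lab p c ∸ 1
    toℕ-code p c = trans (cong (toℕ ∘ code) (remQuot-combine p c)) (toℕ-fromℕ< _)

    code-surjective : ∀ y → ∃ λ i → code (remQuot 6 i) ≡ y
    code-surjective y with lab-surjective {suc (toℕ y)} (s≤s z≤n , subst (toℕ y <_) (*-comm m 6) (toℕ<n y))
    ... | p , c , lab≡ = combine p c , toℕ-injective (begin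
      toℕ (code (remQuot 6 (combine p c)))  ≡⟨ toℕ-code p c ⟩
      lab p c ∸ 1                           ≡⟨ cong (_∸ 1) lab≡ ⟩
      toℕ y                                 ∎)
      where open ≡-Reasoning

  lab-injective : ∀ {p c p' c'} → lab p c ≡ lab p' c' → (p , c) ≡ (p' , c')
  lab-injective {p} {c} {p'} {c'} lab≡ = begin
    (p , c)                         ≡⟨ remQuot-combine p c ⟨
    remQuot 6 (combine p c)         ≡⟨ cong (remQuot 6) (surjective⇒injective code-surjective codes≡) ⟩
    remQuot 6 (combine p' c')       ≡⟨ remQuot-combine p' c' ⟩
    (p' , c')                       ∎
    where
    open ≡-Reasoning
    codes≡ : code (remQuot 6 (combine p c)) ≡ code (remQuot 6 (combine p' c'))
    codes≡ = toℕ-injective (begin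
      toℕ (code (remQuot 6 (combine p c)))    ≡⟨ toℕ-code p c ⟩
      lab p c ∸ 1                              ≡⟨ cong (_∸ 1) lab≡ ⟩
      lab p' c' ∸ 1                            ≡⟨ toℕ-code p' c' ⟨
      toℕ (code (remQuot 6 (combine p' c')))  ∎)

  pathVertex : Fin m → Fin 3 → ℕ
  pathVertex p i = vertexOf (lab p (column i))

  pathVertex-isGVertex : ∀ p i → IsGVertex m (pathVertex p i)
  pathVertex-isGVertex p i = vertexOf-isGVertex (lab-isLabel p (column i))

  pathVertex-mem : ∀ p i → Mem m (pathVertex p i) (lab p (column i))
  pathVertex-mem p i = vertexOf-mem (lab-isLabel p (column i))

  pathVertex-injective : ∀ {p i p' j} → pathVertex p i ≡ pathVertex p' j → p ≡ p' × i ≡ j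
  pathVertex-injective {p} {i} {p'} {j} eq with vertexOf-injective (lab-isLabel p (column i)) (lab-isLabel p' (column j)) eq
  ... | inj₁ lab≡ = cong proj₁ (lab-injective lab≡) , column-injective (cong proj₂ (lab-injective lab≡))
  ... | inj₂ lab≡partner = contradiction (cong proj₂ (lab-injective (trans lab≡partner (sym (lab-flipCol p' (column j))))))
                                    (column≢flipCol-column i j)

  vertexOf-lab : ∀ p c → ∃ λ i → vertexOf (lab p c) ≡ pathVertex p i
  vertexOf-lab p c with column-or-flipCol-column c
  ... | i , inj₁ refl = i , refl
  ... | i , inj₂ refl = i , trans (cong vertexOf (lab-flipCol p (column i))) (vertexOf-partner (lab-isLabel p (column i)))

  step-sum : ∀ p {i j} → PathStep i j → lab p (column i) + lab p (column j) ≡ 6 * m ⊎ lab p (column i) + lab p (column j) ≡ b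
  step-sum p step₀₁ = inj₂ (trans (+-comm (lab p 0F) (lab p 1F)) (lab-sum₁₀ p))
  step-sum p step₁₂ = inj₁ (trans (+-comm (lab p 1F) (lab p 2F)) (lab-sum₂₁ p))

  step-adjacent : ∀ p {i j} → PathStep i j → GAdj m (6 * m) b (pathVertex p i) (pathVertex p j)
  step-adjacent p {i} {j} step = pathVertex-isGVertex p i , pathVertex-isGVertex p j ,
    (λ eq → PathStep-irreflexive (subst (PathStep i) (sym (proj₂ (pathVertex-injective eq))) step)) ,
    lab p (column i) , lab p (column j) , pathVertex-mem p i , pathVertex-mem p j , step-sum p step

  path : Fin m → Path3
  path p = pathVertex p 2F , pathVertex p 1F , pathVertex p 0F

  StepEdge : Fin m → ℕ → ℕ → Set
  StepEdge p u v = ∃₂ λ i j → PathStep i j ×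
    (u ≡ pathVertex p i × v ≡ pathVertex p j ⊎ u ≡ pathVertex p j × v ≡ pathVertex p i)

  pathEdge⇒stepEdge : ∀ {p u v} → PathEdge (path p) u v → StepEdge p u v
  pathEdge⇒stepEdge (inj₁ e) = 1F , 2F , step₁₂ , inj₂ e
  pathEdge⇒stepEdge (inj₂ (inj₁ e)) = 1F , 2F , step₁₂ , inj₁ e
  pathEdge⇒stepEdge (inj₂ (inj₂ (inj₁ e))) = 0F , 1F , step₀₁ , inj₂ e
  pathEdge⇒stepEdge (inj₂ (inj₂ (inj₂ e))) = 0F , 1F , step₀₁ , inj₁ e

  stepEdge⇒pathEdge : ∀ {p u v} → StepEdge p u v → PathEdge (path p) u v
  stepEdge⇒pathEdge (_ , _ , step₀₁ , inj₁ e) = inj₂ (inj₂ (inj₂ e))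
  stepEdge⇒pathEdge (_ , _ , step₀₁ , inj₂ e) = inj₂ (inj₂ (inj₁ e))
  stepEdge⇒pathEdge (_ , _ , step₁₂ , inj₁ e) = inj₂ (inj₁ e)
  stepEdge⇒pathEdge (_ , _ , step₁₂ , inj₂ e) = inj₁ e

  onPath⇒pathVertex : ∀ {p q} → OnPath (path p) q → ∃ λ i → q ≡ pathVertex p i
  onPath⇒pathVertex (inj₁ e) = 2F , e
  onPath⇒pathVertex (inj₂ (inj₁ e)) = 1F , e
  onPath⇒pathVertex (inj₂ (inj₂ e)) = 0F , e

  pathVertex-onPath : ∀ p i → OnPath (path p) (pathVertex p i)
  pathVertex-onPath p 0F = inj₂ (inj₂ refl)
  pathVertex-onPath p 1F = inj₂ (inj₁ refl)
  pathVertex-onPath p 2F = inj₁ refl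

  pathVertex-distinct : ∀ p {i j} → i ≢ j → pathVertex p i ≢ pathVertex p j
  pathVertex-distinct p i≢j = i≢j ∘ proj₂ ∘ pathVertex-injective

  pathGraph : Graph
  pathGraph u v = ∃ λ p → PathEdge (path p) u v

  pathGraph-adjacent : ∀ u v → pathGraph u v → GAdj m (6 * m) b u v
  pathGraph-adjacent u v (p , e) with pathEdge⇒stepEdge e
  ... | _ , _ , step , inj₁ (refl , refl) = step-adjacent p step
  ... | _ , _ , step , inj₂ (refl , refl) = GAdj-sym {m} (step-adjacent p step)

  path-admissible : ∀ p → IsAdmissiblePath m (6 * m) b (path p)
  path-admissible p = pathVertex-isGVertex p 2F , pathVertex-isGVertex p 1F , pathVertex-isGVertex p 0F ,
    pathVertex-distinct p (λ ()) , pathVertex-distinct p (λ ()) , pathVertex-distinct p (λ ()) ,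
    lab p 2F , lab p 1F , lab p 0F , pathVertex-mem p 2F , pathVertex-mem p 1F , pathVertex-mem p 0F ,
    lab-sum₂₁ p , lab-sum₁₀ p

  paths-disjoint : ∀ p p' → p ≢ p' → ∀ q → OnPath (path p) q → ¬ OnPath (path p') q
  paths-disjoint p p' p≢p' q on on' with onPath⇒pathVertex on | onPath⇒pathVertex on'
  ... | i , refl | j , q≡ = p≢p' (proj₁ (pathVertex-injective q≡))

  paths-cover : ∀ q → IsGVertex m q → ∃ λ p → OnPath (path p) q
  paths-cover q (1≤q , q≤3m) with lab-surjective (1≤q , ≤-trans q≤3m 3m≤6m)
  ... | p , c , lab≡q with vertexOf-lab p c
  ... | i , vertexOf≡ = p , subst (OnPath (path p)) q≡ (pathVertex-onPath p i)
    where
    q≡ : pathVertex p i ≡ q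
    q≡ = trans (sym vertexOf≡) (trans (cong vertexOf lab≡q) (vertexOf-≤ q≤3m))

  pathGraph-partition : IsAdmissiblePathPartition m (6 * m) b pathGraph
  pathGraph-partition = pathGraph-adjacent , path , path-admissible , paths-disjoint , paths-cover ,
    λ u v → mk⇔ id id

module Labelings (n E b : ℕ) (n-even : isEven n ≡ true) (E≤1+m : E ≤ suc (suc n)) (range : Range (suc n) b E) where
  m : ℕ
  m = suc n

  open Labels m
  open Construction m E b E≤1+m range

  rowPermutation : Fin (n !) → Permutation′ m
  rowPermutation k = lift₀ (allPermutations n k)

  labeling : Fin (n !) → Labeling m
  labeling k (r , c) = lab (rowPermutation k ⟨$⟩ʳ r) (orient (rowOrientation r) c)

  labeling-oriented : ∀ k r c → labeling k (r , orient (rowOrientation r) c) ≡ lab (rowPermutation k ⟨$⟩ʳ r) c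
  labeling-oriented k r c = cong (lab (rowPermutation k ⟨$⟩ʳ r)) (orient-involutive (rowOrientation r) c)

  face-sum-between-rows : ∀ {e e'} → e' ≡ not e → ∀ p p' c →
    lab p (orient e c) + lab p (orient e (nextCol c)) + lab p' (orient e' c) + lab p' (orient e' (nextCol c)) ≡ faceSum
  face-sum-between-rows {true} refl p p' c = face-sum p p' c
  face-sum-between-rows {false} refl p p' c =
    trans (+-swap-pairs (lab p (flipCol c)) (lab p (flipCol (nextCol c))) (lab p' c) (lab p' (nextCol c))) (face-sum p' p c)

  face-sum-across-twist : ∀ {e e'} → e ≡ true → e' ≡ true → ∀ p p' c →
    lab p (orient e c) + lab p (orient e (nextCol c))
      + lab p' (orient e' (flipCol c)) + lab p' (orient e' (flipCol (nextCol c))) ≡ faceSum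
  face-sum-across-twist refl refl = face-sum

  labeling-faces : ∀ k → AllFaceSums m (labeling k) faceSum
  labeling-faces k =
    (λ r r' c r'≡1+r → face-sum-between-rows (trans (cong isEven r'≡1+r) (isEven-suc (toℕ r))) (π r) (π r') c) ,
    (λ r r' c 1+r≡m r'≡0 →
      face-sum-across-twist (trans (cong isEven (suc-injective 1+r≡m)) n-even) (cong isEven r'≡0) (π r) (π r') c)
    where
    π : Fin m → Fin m
    π = rowPermutation k ⟨$⟩ʳ_

  labeling-injective : ∀ k {v w} → labeling k v ≡ labeling k w → v ≡ w
  labeling-injective k {r , c} {r' , c'} eq = same-row (Injection.injective (↔⇒↣ ρ) (cong proj₁ cells≡)) (cong proj₂ cells≡)
    where
    ρ : Permutation′ m
    ρ = rowPermutation k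
    cells≡ : (ρ ⟨$⟩ʳ r , orient (rowOrientation r) c) ≡ (ρ ⟨$⟩ʳ r' , orient (rowOrientation r') c')
    cells≡ = lab-injective {ρ ⟨$⟩ʳ r} {orient (rowOrientation r) c} {ρ ⟨$⟩ʳ r'} {orient (rowOrientation r') c'} eq
    same-row : r ≡ r' → orient (rowOrientation r) c ≡ orient (rowOrientation r') c' → (r , c) ≡ (r' , c')
    same-row refl o≡ = cong (r ,_) (orient-injective (rowOrientation r) o≡)

  labeling-surjective : ∀ k x → 1 ≤ x → x ≤ 6 * m → ∃ λ v → labeling k v ≡ x
  labeling-surjective k x 1≤x x≤6m with lab-surjective (1≤x , x≤6m)
  ... | p , c , lab≡x = (r , orient (rowOrientation r) c) ,
                        trans (labeling-oriented k r c) (trans (cong (λ p → lab p c) (inverseʳ (rowPermutation k))) lab≡x)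
    where
    r : Fin m
    r = rowPermutation k ⟨$⟩ˡ p

  labeling-bijective : ∀ k → IsBijectiveLabeling m (labeling k)
  labeling-bijective k = (λ { (r , c) → lab-isLabel _ _ }) , (λ v w → labeling-injective k) , labeling-surjective k

  labeling-mem-pathVertex : ∀ k p i → let r = rowPermutation k ⟨$⟩ˡ p in
    Mem m (pathVertex p i) (labeling k (r , orient (rowOrientation r) (column i)))
  labeling-mem-pathVertex k p i = subst (Mem m (pathVertex p i))
    (sym (trans (labeling-oriented k _ (column i)) (cong (λ p → lab p (column i)) (inverseʳ (rowPermutation k)))))
    (pathVertex-mem p i)

  mem-labeling : ∀ k r i {u} → IsGVertex m u → Mem m u (labeling k (r , orient (rowOrientation r) (column i))) →
    u ≡ pathVertex (rowPermutation k ⟨$⟩ʳ r) i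
  mem-labeling k r i u∈ u-mem = trans (mem⇒vertexOf u∈ u-mem) (cong vertexOf (labeling-oriented k r (column i)))

  labeling-LGraph : ∀ k → SameGraph (LGraph m (labeling k)) pathGraph
  labeling-LGraph k u v = mk⇔ to from
    where
    to : LGraph m (labeling k) u v → pathGraph u v
    to (u∈ , v∈ , r , c , c' , lpair , mems) with LPair⇒step lpair
    ... | i , j , step , refl , refl = rowPermutation k ⟨$⟩ʳ r , stepEdge⇒pathEdge (i , j , step , Sum.map
      (λ (u-mem , v-mem) → mem-labeling k r i u∈ u-mem , mem-labeling k r j v∈ v-mem)
      (λ (v-mem , u-mem) → mem-labeling k r j u∈ u-mem , mem-labeling k r i v∈ v-mem) mems)
    from : pathGraph u v → LGraph m (labeling k) u v
    from (p , edge) with pathEdge⇒stepEdge edge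
    ... | i , j , step , inj₁ (refl , refl) =
      pathVertex-isGVertex p i , pathVertex-isGVertex p j , r , _ , _ , LPair-step r step ,
      inj₁ (labeling-mem-pathVertex k p i , labeling-mem-pathVertex k p j)
      where
        r : Fin m
        r = rowPermutation k ⟨$⟩ˡ p
    ... | i , j , step , inj₂ (refl , refl) =
      pathVertex-isGVertex p j , pathVertex-isGVertex p i , r , _ , _ , LPair-step r step ,
      inj₂ (labeling-mem-pathVertex k p i , labeling-mem-pathVertex k p j)
      where
        r : Fin m
        r = rowPermutation k ⟨$⟩ˡ p

  labelings-nonequivalent : ∀ k k' → k ≢ k' → ¬ KBEquivalent m (labeling k) (labeling k')
  labelings-nonequivalent k k' k≢k' (w , equivalent) with rowAction w
  ... | f , on-rows , commutes = k≢k' (sym (allPermutations-injective n λ x →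
          FinProps.suc-injective (trans (same-path (suc x)) (cong (π k) (f≡id (suc x))))))
    where
    π : Fin (n !) → Fin m → Fin m
    π k = rowPermutation k ⟨$⟩ʳ_
    same-path : ∀ r → π k' r ≡ π k (f r)
    same-path r = trans (cong proj₁ (lab-injective (equivalent (r , 0F)))) (cong (π k) (on-rows r 0F))
    f≡id : ∀ r → f r ≡ r
    f≡id = equivariant-fixing-zero⇒id f commutes (Injection.injective (↔⇒↣ (rowPermutation k)) (sym (same-path 0F)))

proposition6p2 : (m : ℕ) → 3 ≤ m → Odd m → (b : ℕ) →
    ((3 * m + 1 ≤ b × b ≤ 4 * m + 1) ⊎ (8 * m ≤ b × b ≤ 9 * m + 1)) →
    Σ Graph λ K →
      IsAdmissiblePathPartition m (6 * m) b K ×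
      Σ (Fin ((m ∸ 1) !) → Labeling m) λ Xs →
        (∀ k → IsC4FaceMagicKB m (Xs k)) ×
        (∀ k → SameGraph (LGraph m (Xs k)) K) ×
        (∀ k k' → k ≢ k' → ¬ KBEquivalent m (Xs k) (Xs k'))
proposition6p2 _ _ (h , refl) b b-range with range-parameter (suc (2 * h)) b b-range
... | E , E≤1+m , range =
  pathGraph , pathGraph-partition , labeling ,
  (λ k → labeling-bijective k , faceSum , labeling-faces k) , labeling-LGraph , labelings-nonequivalent
  where
  open Construction (suc (2 * h)) E b E≤1+m range
  open Labelings (2 * h) E b (isEven-double h) E≤1+m range
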